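{- Let $\Delta\ge1$, let $V$ be a vertex set with $|V|=n$, and let $a,b,k_1,k_2$ be the nonnegative integers with $n=a(2\Delta-1)+b$, $b(\Delta-1)=k_1(2\Delta-1)+k_2$, $0\le b,k_2\le 2\Delta-2$. If $\mathfrak{A}(n,\Delta)\neq\emptyset$, then every $\mathcal{S}\in\mathfrak{A}(n,\Delta)$ is rainbow $K_{1,\Delta}$-free.
   Context: A collection of graphs on $V$ is a finite family (multiset) of graphs with vertices in $V$. A collection $\mathcal{G}=\{G_1,\dots,G_t\}$ contains a rainbow $H$ if there is a graph isomorphic to $H$ whose edges can be assigned injectively to indices $i$ with each edge in the assigned $G_i$; otherwise it is rainbow $H$-free. A star $K_{1,\Delta}$ has a center and $\Delta$ leaves. For a collection $\mathcal{S}$ of stars $K_{1,\Delta}$ on $V$: $\mathcal{S}_u$ is the subcollection of stars with center $u$; $C=\{u:\mathcal{S}_u\ne\emptyset\}$, $L=V\setminus C$; $\overrightarrow{D}$ is the digraph on $V$ with arcs $(x,y)$ whenever $xy$ is an edge of some star in $\mathcal{S}_x$; $d^\pm_{\overrightarrow{D}}$ denote out/in-degrees, $\overrightarrow{D}[C]$ the induced subdigraph, $A(\cdot)$ its arc set; $d$-out-regular means all out-degrees equal $d$. $\mathfrak{A}(n,\Delta)$ is the set of collections $\mathcal{S}$ of stars $K_{1,\Delta}$ on $V$ satisfying: (i) if $n\ge 2\Delta-1$ and $k_2<\Delta$: $|\mathcal{S}|=a(\Delta-1)^2+k_1(\Delta-1)$; $|C|=a(\Delta-1)+k_1$; each $u\in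 C$ is the center of exactly $\Delta-1$ stars of $\mathcal{S}$, all of whose leaves lie in $L$; $d^-_{\overrightarrow{D}}(v)\le\Delta-1$ for all $v\in L$. (ii) if $n\ge 2\Delta-1$ and $k_2>\Delta$: $|\mathcal{S}|=a(\Delta-1)^2+k_1(\Delta-1)+k_2-\Delta$; $|C|=a(\Delta-1)+k_1+1$, $|A(\overrightarrow{D}[C])|=2\Delta-1-k_2$; each $u\in C$ is the center of exactly $\Delta-1-d^-_{\overrightarrow{D}}(u)$ stars of $\mathcal{S}$; $d^-_{\overrightarrow{D}}(v)=\Delta-1$ for all $v\in L$. (iii) if $n\ge 2\Delta-1$ and $k_2=\Delta$: $|\mathcal{S}|=a(\Delta-1)^2+k_1(\Delta-1)$ and $\mathcal{S}$ satisfies the conditions of (i) or of (ii). (iv) if $\Delta+1\le n\le 2\Delta-2$: $|\mathcal{S}|=\lfloor (n-1)^2/4\rfloor$; $|C|=\lfloor (n-1)/2\rfloor$ if $n$ is odd, $|C|\in\{\lfloor (n-1)/2\rfloor,\lceil (n-1)/2\rceil\}$ if $n$ is even; $\overrightarrow{D}[C]$ is $(\Delta-|L|)$-out-regular; for each $u\in C$, $\mathcal{S}_u$ consists of $\Delta-1-d^-_{\overrightarrow{D}}(u)$ copies of $K_{1,\Delta}$ and $L$ is contained in the leaf set of each star of $\mathcal{S}_u$. -}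

module Defs where

open import Data.Nat using (ℕ; zero; suc; _+_; _*_; _∸_; _≤_; _<_; _≥_; _/_)
open import Data.Bool using (Bool; true; false; _∧_; not)
open import Data.Fin using (Fin; _≟_)
open import Data.Fin.Subset using (Subset; _∈_; _∉_; _⊆_; ∁; ∣_∣)
open import Data.Vec using (tabulate; lookup)
open import Data.List using (List; length; filterᵇ; map; allFin)
open import Data.Bool.ListAction using (any)
open import Data.Nat.ListAction using (sum)
import Data.List as L
open import Data.List.Membership.Propositional using () renaming (_∈_ to _∈ₗ_)
open import Data.Product using (Σ; ∃; _×_; _,_)
open import Data.Sum using (_⊎_)
open import Relation.Nullary using (¬_)
open import Relation.Nullary.Decidable using (⌊_⌋)
open import Relation.Binary.PropositionalEquality using (_≡_; _≢_)
open import Function.Definitions using (Injective)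

record Star (n Δ : ℕ) : Set where
  constructor star
  field
    center   : Fin n
    leaves   : Subset n
    size     : ∣ leaves ∣ ≡ Δ
    noLoop   : center ∉ leaves
open Star public

-- A collection of stars (a multiset, represented as a list; indices are positions).
Collection : ℕ → ℕ → Set
Collection n Δ = List (Star n Δ)

EdgeOf : ∀ {n Δ} → Star n Δ → Fin n → Fin n → Set
EdgeOf s x y = (center s ≡ x × y ∈ leaves s) ⊎ (center s ≡ y × x ∈ leaves s)

-- Rainbow K_{1,Δ}: a center x and Δ distinct leaves f j ≠ x, and an injective
-- assignment g of the Δ edges x(f j) to members of the collection containing them.
RainbowStar : ∀ {n Δ} → Collection n Δ → Set
RainbowStar {n} {Δ} S =
  Σ (Fin n) λ x → Σ (Fin Δ → Fin n) λ f → Σ (Fin Δ → Fin (length S)) λ g →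
    Injective _≡_ _≡_ f × (∀ j → f j ≢ x) × Injective _≡_ _≡_ g ×
    (∀ j → EdgeOf (L.lookup S (g j)) x (f j))

RainbowStarFree : ∀ {n Δ} → Collection n Δ → Set
RainbowStarFree S = ¬ RainbowStar S

module _ {n Δ : ℕ} (S : Collection n Δ) where

  centeredAt : Fin n → Star n Δ → Bool
  centeredAt u s = ⌊ center s ≟ u ⌋

  numStarsAt : Fin n → ℕ
  numStarsAt u = length (filterᵇ (centeredAt u) S)

  Cset : Subset n
  Cset = tabulate λ u → any (centeredAt u) S

  Lset : Subset n
  Lset = ∁ Cset

  -- arc (x,y) of the digraph D: xy is an edge of some star of S_x
  arcᵇ : Fin n → Fin n → Bool
  arcᵇ x y = any (λ s → centeredAt x s ∧ lookup (leaves s) y) S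

  inDeg : Fin n → ℕ
  inDeg v = ∣ tabulate (λ x → arcᵇ x v) ∣

  outDegC : Fin n → ℕ
  outDegC u = ∣ tabulate (λ y → arcᵇ u y ∧ lookup Cset y) ∣

  arcsC : ℕ
  arcsC = sum (map (λ x → if′ lookup Cset x then outDegC x else 0) (allFin n))
    where
    if′_then_else_ : Bool → ℕ → ℕ → ℕ
    if′ true then a else b = a
    if′ false then a else b = b

  -- condition (i) (without the hypotheses on n, k₂)
  CondI : (a k₁ : ℕ) → Set
  CondI a k₁ =
    length S ≡ a * (Δ ∸ 1) * (Δ ∸ 1) + k₁ * (Δ ∸ 1) ×
    ∣ Cset ∣ ≡ a * (Δ ∸ 1) + k₁ ×
    (∀ u → u ∈ Cset → numStarsAt u ≡ Δ ∸ 1) ×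
    (∀ s → s ∈ₗ S → leaves s ⊆ Lset) ×
    (∀ v → v ∈ Lset → inDeg v ≤ Δ ∸ 1)

  -- condition (ii) (without the hypotheses on n, k₂)
  CondII : (a k₁ k₂ : ℕ) → Set
  CondII a k₁ k₂ =
    length S ≡ a * (Δ ∸ 1) * (Δ ∸ 1) + k₁ * (Δ ∸ 1) + (k₂ ∸ Δ) ×
    ∣ Cset ∣ ≡ a * (Δ ∸ 1) + k₁ + 1 ×
    arcsC ≡ 2 * Δ ∸ 1 ∸ k₂ ×
    (∀ u → u ∈ Cset → numStarsAt u ≡ Δ ∸ 1 ∸ inDeg u) ×
    (∀ v → v ∈ Lset → inDeg v ≡ Δ ∸ 1)

  -- condition (iv) (without the hypothesis on n)
  CondIV : Set
  CondIV =
    length S ≡ ((n ∸ 1) * (n ∸ 1)) / 4 ×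
    (∣ Cset ∣ ≡ (n ∸ 1) / 2 ⊎ (Σ ℕ λ m → n ≡ 2 * m × ∣ Cset ∣ ≡ n / 2)) ×
    (∀ u → u ∈ Cset → outDegC u ≡ Δ ∸ ∣ Lset ∣) ×
    (∀ u → u ∈ Cset → numStarsAt u ≡ Δ ∸ 1 ∸ inDeg u) ×
    (∀ s → s ∈ₗ S → Lset ⊆ leaves s)

-- S ∈ 𝔄(n,Δ), where a, k₁, k₂ are the parameters defined from n and Δ
-- (n = a(2Δ-1)+b, b(Δ-1) = k₁(2Δ-1)+k₂).
InFrakA : (n Δ a k₁ k₂ : ℕ) → Collection n Δ → Set
InFrakA n Δ a k₁ k₂ S =
  (n ≥ 2 * Δ ∸ 1 × k₂ < Δ × CondI S a k₁) ⊎
  (n ≥ 2 * Δ ∸ 1 × Δ < k₂ × CondII S a k₁ k₂) ⊎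
  (n ≥ 2 * Δ ∸ 1 × k₂ ≡ Δ × (CondI S a k₁ ⊎ CondII S a k₁ k₂)) ⊎
  (Δ + 1 ≤ n × n ≤ 2 * Δ ∸ 2 × CondIV S)

{-# OPTIONS --safe #-}
-- A rainbow K_{1,Δ} centred at x uses Δ distinct stars of S.  Each of them is either centred
-- at x, or centred at a leaf y of the rainbow star with x among its leaves, giving an arc
-- (y,x) of D; the two injections give Δ ≤ |S_x| + d⁻(x).  Every member of 𝔄(n,Δ) has
-- |S_x| + d⁻(x) < Δ at every vertex: on L, |S_x| = 0 and d⁻(x) ≤ Δ-1 (in case (iv) since
-- d⁻(x) ≤ |C| ≤ Δ-1); on C, |S_x| = Δ-1-d⁻(x) is positive (in case (i) d⁻(x) = 0, all
-- leaves lying in L).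
module Submission where

open import Defs
open import Data.Nat using (ℕ; suc; _+_; _*_; _∸_; _/_; _≤_; _<_; _≥_; z≤n; s≤s)
open import Data.Nat.Properties
  using (≤-reflexive; ≤-trans; <⇒≤; <⇒≱; +-mono-≤; +-identityʳ; *-comm; *-distribˡ-∸; m∸n≤m;
         m+[n∸m]≡n; m∸n+n≡m; m∸n≢0⇒n<m; n≤0⇒n≡0; module ≤-Reasoning)
open import Data.Nat.DivMod using (/-monoˡ-≤; m*n/n≡m)
open import Data.Bool using (Bool; true; false; _∧_)
open import Data.Bool.Properties using (∨-zeroʳ)
open import Data.Fin using (Fin; zero; suc; _≟_)
open import Data.Fin.Properties using (suc-injective; 0≢1+n)
open import Data.Fin.Subset using (Subset; _∈_; _∉_; _⊆_; ∁; ∣_∣; _-_; inside; outside; ⊥)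
open import Data.Fin.Subset.Properties
  using (_∈?_; ∣∁p∣≡n∸∣p∣; ∣p∣≤n; ∣⊥∣≡0; p─⊥≡p; p⊆q⇒∣p∣≤∣q∣;
         x∈p∧x∉q⇒x∈p─q; x≢y⇒x∉⁅y⁆; x∈∁p⇒x∉p; x∉p⇒x∈∁p)
open import Data.Vec using ([]; _∷_; tabulate; lookup; here; there)
open import Data.Vec.Properties using (lookup∘tabulate; []=⇒lookup; lookup⇒[]=)
open import Data.List using (List; length; filterᵇ)
import Data.List as List
open import Data.Bool.ListAction using (any)
open import Data.List.Relation.Unary.Any using (here; there)
open import Data.List.Membership.Propositional using () renaming (_∈_ to _∈ₗ_)
open import Data.List.Membership.Propositional.Properties using (∈-lookup)
open import Data.Product using (Σ; ∃; _×_; _,_)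
open import Data.Sum using (_⊎_; inj₁; inj₂)
open import Data.Empty using (⊥-elim)
open import Function using (_∘_)
open import Function.Definitions using (Injective)
open import Relation.Nullary using (yes; no)
open import Relation.Binary.PropositionalEquality
open ≤-Reasoning

x∈p⇒suc∣p-x∣≡∣p∣ : ∀ {n} {p : Subset n} {x} → x ∈ p → suc ∣ p - x ∣ ≡ ∣ p ∣
x∈p⇒suc∣p-x∣≡∣p∣ {p = inside ∷ p} here = cong (suc ∘ ∣_∣) (p─⊥≡p p)
x∈p⇒suc∣p-x∣≡∣p∣ {p = inside ∷ _} (there x∈p) = cong suc (x∈p⇒suc∣p-x∣≡∣p∣ x∈p)
x∈p⇒suc∣p-x∣≡∣p∣ {p = outside ∷ _} (there x∈p) = x∈p⇒suc∣p-x∣≡∣p∣ x∈p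

injective⇒∣p∣≤∣q∣ : ∀ {k n} {p : Subset k} {q : Subset n} (f : Fin k → Fin n) →
  Injective _≡_ _≡_ f → (∀ {j} → j ∈ p → f j ∈ q) → ∣ p ∣ ≤ ∣ q ∣
injective⇒∣p∣≤∣q∣ {p = []} f _ _ = z≤n
injective⇒∣p∣≤∣q∣ {p = outside ∷ _} f f-inj f[p]⊆q =
  injective⇒∣p∣≤∣q∣ (f ∘ suc) (suc-injective ∘ f-inj) (f[p]⊆q ∘ there)
injective⇒∣p∣≤∣q∣ {p = inside ∷ p} {q} f f-inj f[p]⊆q = begin
  suc ∣ p ∣          ≤⟨ s≤s (injective⇒∣p∣≤∣q∣ (f ∘ suc) (suc-injective ∘ f-inj) f[p]⊆q-f0) ⟩
  suc ∣ q - f zero ∣ ≡⟨ x∈p⇒suc∣p-x∣≡∣p∣ (f[p]⊆q here) ⟩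
  ∣ q ∣              ∎
  where
  f[p]⊆q-f0 : ∀ {j} → j ∈ p → f (suc j) ∈ q - f zero
  f[p]⊆q-f0 j∈p = x∈p∧x∉q⇒x∈p─q (f[p]⊆q (there j∈p)) (x≢y⇒x∉⁅y⁆ (0≢1+n ∘ sym ∘ f-inj))

∈-tabulate⁺ : ∀ {n} (h : Fin n → Bool) {j} → h j ≡ true → j ∈ tabulate h
∈-tabulate⁺ h {j} hj = lookup⇒[]= j _ (trans (lookup∘tabulate h j) hj)

∈-tabulate⁻ : ∀ {n} (h : Fin n → Bool) {j} → j ∈ tabulate h → h j ≡ true
∈-tabulate⁻ h {j} j∈h = trans (sym (lookup∘tabulate h j)) ([]=⇒lookup j∈h)

∧≡true⁻ : ∀ b {c} → b ∧ c ≡ true → b ≡ true × c ≡ true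
∧≡true⁻ true c≡true = refl , c≡true

module _ {A : Set} (P : A → Bool) where

  ∣tabulate∘lookup∣≡length∘filterᵇ : (xs : List A) →
    ∣ tabulate (P ∘ List.lookup xs) ∣ ≡ length (filterᵇ P xs)
  ∣tabulate∘lookup∣≡length∘filterᵇ List.[] = refl
  ∣tabulate∘lookup∣≡length∘filterᵇ (x List.∷ xs) with P x
  ... | true  = cong suc (∣tabulate∘lookup∣≡length∘filterᵇ xs)
  ... | false = ∣tabulate∘lookup∣≡length∘filterᵇ xs

  any-∈ : ∀ {x xs} → x ∈ₗ xs → P x ≡ true → any P xs ≡ true
  any-∈ (here refl) Px rewrite Px = refl
  any-∈ {xs = y List.∷ _} (there x∈ys) Px rewrite any-∈ x∈ys Px = ∨-zeroʳ (P y)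

  any⁻ : ∀ xs → any P xs ≡ true → ∃ λ x → x ∈ₗ xs × P x ≡ true
  any⁻ (y List.∷ ys) anyP with P y in Py
  ... | true  = y , here refl , Py
  ... | false = let x , x∈ys , Px = any⁻ ys anyP in x , there x∈ys , Px

  any≡false⇒length-filterᵇ≡0 : ∀ xs → any P xs ≡ false → length (filterᵇ P xs) ≡ 0
  any≡false⇒length-filterᵇ≡0 List.[] _ = refl
  any≡false⇒length-filterᵇ≡0 (x List.∷ xs) anyP with P x
  ... | false = any≡false⇒length-filterᵇ≡0 xs anyP

  any≡true⇒length-filterᵇ≢0 : ∀ xs → any P xs ≡ true → length (filterᵇ P xs) ≢ 0
  any≡true⇒length-filterᵇ≢0 (x List.∷ xs) anyP with P x
  ... | true  = λ ()
  ... | false = any≡true⇒length-filterᵇ≢0 xs anyP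

module _ {n Δ : ℕ} (S : Collection n Δ) where

  centeredAt-≡ : ∀ {s u} → center s ≡ u → centeredAt S u s ≡ true
  centeredAt-≡ {s} {u} c≡u with center s ≟ u
  ... | yes _   = refl
  ... | no c≢u = ⊥-elim (c≢u c≡u)

  ∉Cset⇒numStarsAt≡0 : ∀ {u} → u ∉ Cset S → numStarsAt S u ≡ 0
  ∉Cset⇒numStarsAt≡0 {u} u∉C with any (centeredAt S u) S in anyS
  ... | true  = ⊥-elim (u∉C (∈-tabulate⁺ (λ u → any (centeredAt S u) S) anyS))
  ... | false = any≡false⇒length-filterᵇ≡0 _ S anyS

  ∈Cset⇒numStarsAt≢0 : ∀ {u} → u ∈ Cset S → numStarsAt S u ≢ 0
  ∈Cset⇒numStarsAt≢0 u∈C =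
    any≡true⇒length-filterᵇ≢0 _ S (∈-tabulate⁻ (λ u → any (centeredAt S u) S) u∈C)

  arc⁺ : ∀ {s x y} → s ∈ₗ S → center s ≡ x → y ∈ leaves s → arcᵇ S x y ≡ true
  arc⁺ {s} s∈S c≡x y∈s = any-∈ _ s∈S (subst₂ (λ c l → (c ∧ l) ≡ true)
    (sym (centeredAt-≡ {s} c≡x)) (sym ([]=⇒lookup y∈s)) refl)

  arc⁻ : ∀ {x y} → arcᵇ S x y ≡ true → ∃ λ s → s ∈ₗ S × centeredAt S x s ≡ true × y ∈ leaves s
  arc⁻ {x} {y} arc with any⁻ _ S arc
  ... | s , s∈S , cs∧ls with ∧≡true⁻ (centeredAt S x s) cs∧ls
  ...   | cs , ls = s , s∈S , cs , lookup⇒[]= y (leaves s) ls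

  inDeg≤∣Cset∣ : ∀ v → inDeg S v ≤ ∣ Cset S ∣
  inDeg≤∣Cset∣ v = p⊆q⇒∣p∣≤∣q∣ λ x∈N →
    let _ , s∈S , cs , _ = arc⁻ (∈-tabulate⁻ (λ x → arcᵇ S x v) x∈N) in
    ∈-tabulate⁺ (λ u → any (centeredAt S u) S) (any-∈ _ s∈S cs)

  leaves⊆Lset⇒inDeg≡0 : (∀ s → s ∈ₗ S → leaves s ⊆ Lset S) → ∀ {u} → u ∈ Cset S → inDeg S u ≡ 0
  leaves⊆Lset⇒inDeg≡0 leaves⊆L {u} u∈C = n≤0⇒n≡0 (begin
    inDeg S u         ≤⟨ p⊆q⇒∣p∣≤∣q∣ no-in-neighbour ⟩
    ∣ ⊥ {n = n} ∣     ≡⟨ ∣⊥∣≡0 n ⟩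
    0                 ∎)
    where
    no-in-neighbour : tabulate (λ x → arcᵇ S x u) ⊆ ⊥
    no-in-neighbour x∈N = let s , s∈S , _ , u∈s = arc⁻ (∈-tabulate⁻ (λ x → arcᵇ S x u) x∈N) in
      ⊥-elim (x∈∁p⇒x∉p (leaves⊆L s s∈S u∈s) u∈C)

  rainbowStar⇒Δ≤numStarsAt+inDeg : RainbowStar S → ∃ λ x → Δ ≤ numStarsAt S x + inDeg S x
  rainbowStar⇒Δ≤numStarsAt+inDeg (x , f , g , f-inj , _ , g-inj , edge) = x , (begin
    Δ                               ≡⟨ m+[n∸m]≡n (∣p∣≤n P) ⟨
    ∣ P ∣ + (Δ ∸ ∣ P ∣)             ≡⟨ cong (∣ P ∣ +_) (∣∁p∣≡n∸∣p∣ P) ⟨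
    ∣ P ∣ + ∣ ∁ P ∣                 ≤⟨ +-mono-≤ ∣P∣≤numStarsAt ∣∁P∣≤inDeg ⟩
    numStarsAt S x + inDeg S x     ∎)
    where
    edgeStar : Fin Δ → Star n Δ
    edgeStar j = List.lookup S (g j)

    P : Subset Δ
    P = tabulate (centeredAt S x ∘ edgeStar)

    ∣P∣≤numStarsAt : ∣ P ∣ ≤ numStarsAt S x
    ∣P∣≤numStarsAt = begin
      ∣ P ∣
        ≤⟨ injective⇒∣p∣≤∣q∣ g g-inj (∈-tabulate⁺ _ ∘ ∈-tabulate⁻ (centeredAt S x ∘ edgeStar)) ⟩
      ∣ tabulate (centeredAt S x ∘ List.lookup S) ∣
        ≡⟨ ∣tabulate∘lookup∣≡length∘filterᵇ (centeredAt S x) S ⟩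
      numStarsAt S x
        ∎

    reversed-edge : ∀ {j} → j ∈ ∁ P → center (edgeStar j) ≡ f j × x ∈ leaves (edgeStar j)
    reversed-edge {j} j∉P with edge j
    ... | inj₂ e         = e
    ... | inj₁ (c≡x , _) =
      ⊥-elim (x∈∁p⇒x∉p j∉P (∈-tabulate⁺ (centeredAt S x ∘ edgeStar) (centeredAt-≡ {edgeStar j} c≡x)))

    ∣∁P∣≤inDeg : ∣ ∁ P ∣ ≤ inDeg S x
    ∣∁P∣≤inDeg = injective⇒∣p∣≤∣q∣ f f-inj λ {j} j∉P → let c≡fj , x∈s = reversed-edge j∉P in
      ∈-tabulate⁺ (λ y → arcᵇ S y x) (arc⁺ (∈-lookup (g j)) c≡fj x∈s)

  StarInDegBound : Set
  StarInDegBound = ∀ x → numStarsAt S x + inDeg S x < Δ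

  starInDegBound⇒rainbowStarFree : StarInDegBound → RainbowStarFree S
  starInDegBound⇒rainbowStarFree bound rainbow =
    let x , Δ≤ = rainbowStar⇒Δ≤numStarsAt+inDeg rainbow in <⇒≱ (bound x) Δ≤

≡[n∸1]/2⊎≡n/2⇒≤n/2 : ∀ {n c} → c ≡ (n ∸ 1) / 2 ⊎ (Σ ℕ λ k → n ≡ 2 * k × c ≡ n / 2) → c ≤ n / 2
≡[n∸1]/2⊎≡n/2⇒≤n/2 {n} (inj₁ c≡) = ≤-trans (≤-reflexive c≡) (/-monoˡ-≤ 2 (m∸n≤m n 1))
≡[n∸1]/2⊎≡n/2⇒≤n/2 (inj₂ (_ , _ , c≡)) = ≤-reflexive c≡

[2*n∸2]/2≡n∸1 : ∀ n → (2 * n ∸ 2) / 2 ≡ n ∸ 1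
[2*n∸2]/2≡n∸1 n = begin-equality
  (2 * n ∸ 2) / 2     ≡⟨ cong (_/ 2) (*-distribˡ-∸ 2 n 1) ⟨
  (2 * (n ∸ 1)) / 2   ≡⟨ cong (_/ 2) (*-comm 2 (n ∸ 1)) ⟩
  ((n ∸ 1) * 2) / 2   ≡⟨ m*n/n≡m (n ∸ 1) 2 ⟩
  n ∸ 1               ∎

module _ {n m : ℕ} (S : Collection n (suc m)) where

  ∉Cset⇒numStarsAt+inDeg<Δ : ∀ {u} → u ∉ Cset S → inDeg S u ≤ m → numStarsAt S u + inDeg S u < suc m
  ∉Cset⇒numStarsAt+inDeg<Δ u∉C d≤m rewrite ∉Cset⇒numStarsAt≡0 S u∉C = s≤s d≤m

  condI⇒starInDegBound : ∀ a k₁ → CondI S a k₁ → StarInDegBound S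
  condI⇒starInDegBound _ _ (_ , _ , numStars≡ , leaves⊆L , inDeg≤) x with x ∈? Cset S
  ... | yes x∈C rewrite numStars≡ x x∈C | leaves⊆Lset⇒inDeg≡0 S leaves⊆L x∈C =
    s≤s (≤-reflexive (+-identityʳ m))
  ... | no x∉C = ∉Cset⇒numStarsAt+inDeg<Δ x∉C (inDeg≤ x (x∉p⇒x∈∁p x∉C))

  balanced⇒starInDegBound : (∀ u → u ∈ Cset S → numStarsAt S u ≡ m ∸ inDeg S u) →
    (∀ v → v ∈ Lset S → inDeg S v ≤ m) → StarInDegBound S
  balanced⇒starInDegBound numStars≡ inDeg≤ x with x ∈? Cset S
  ... | no x∉C = ∉Cset⇒numStarsAt+inDeg<Δ x∉C (inDeg≤ x (x∉p⇒x∈∁p x∉C))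
  ... | yes x∈C = s≤s (≤-reflexive (begin-equality
    numStarsAt S x + inDeg S x   ≡⟨ cong (_+ inDeg S x) (numStars≡ x x∈C) ⟩
    m ∸ inDeg S x + inDeg S x    ≡⟨ m∸n+n≡m (<⇒≤ inDeg<m) ⟩
    m                             ∎))
    where
    -- Without S_x ≠ ∅ the truncated subtraction m ∸ d⁻(x) could hide d⁻(x) > m.
    inDeg<m : inDeg S x < m
    inDeg<m = m∸n≢0⇒n<m (subst (_≢ 0) (numStars≡ x x∈C) (∈Cset⇒numStarsAt≢0 S x∈C))

  condII⇒starInDegBound : ∀ a k₁ k₂ → CondII S a k₁ k₂ → StarInDegBound S
  condII⇒starInDegBound _ _ _ (_ , _ , _ , numStars≡ , inDeg≡) =
    balanced⇒starInDegBound numStars≡ (λ v v∈L → ≤-reflexive (inDeg≡ v v∈L))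

  condIV⇒starInDegBound : n ≤ 2 * suc m ∸ 2 → CondIV S → StarInDegBound S
  condIV⇒starInDegBound n≤ (_ , ∣C∣≡ , _ , numStars≡ , _) =
    balanced⇒starInDegBound numStars≡ λ v _ → begin
      inDeg S v              ≤⟨ inDeg≤∣Cset∣ S v ⟩
      ∣ Cset S ∣             ≤⟨ ≡[n∸1]/2⊎≡n/2⇒≤n/2 ∣C∣≡ ⟩
      n / 2                  ≤⟨ /-monoˡ-≤ 2 n≤ ⟩
      (2 * suc m ∸ 2) / 2    ≡⟨ [2*n∸2]/2≡n∸1 (suc m) ⟩
      m                      ∎

  inFrakA⇒starInDegBound : ∀ a k₁ k₂ → InFrakA n (suc m) a k₁ k₂ S → StarInDegBound S
  inFrakA⇒starInDegBound a k₁ k₂ (inj₁ (_ , _ , condI)) = condI⇒starInDegBound a k₁ condI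
  inFrakA⇒starInDegBound a k₁ k₂ (inj₂ (inj₁ (_ , _ , condII))) =
    condII⇒starInDegBound a k₁ k₂ condII
  inFrakA⇒starInDegBound a k₁ k₂ (inj₂ (inj₂ (inj₁ (_ , _ , inj₁ condI)))) =
    condI⇒starInDegBound a k₁ condI
  inFrakA⇒starInDegBound a k₁ k₂ (inj₂ (inj₂ (inj₁ (_ , _ , inj₂ condII)))) =
    condII⇒starInDegBound a k₁ k₂ condII
  inFrakA⇒starInDegBound a k₁ k₂ (inj₂ (inj₂ (inj₂ (_ , n≤ , condIV)))) =
    condIV⇒starInDegBound n≤ condIV

lemma2p2 : (Δ n a b k₁ k₂ : ℕ) → Δ ≥ 1 →
    n ≡ a * (2 * Δ ∸ 1) + b →
    b * (Δ ∸ 1) ≡ k₁ * (2 * Δ ∸ 1) + k₂ →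
    b ≤ 2 * Δ ∸ 2 → k₂ ≤ 2 * Δ ∸ 2 →
    Σ (Collection n Δ) (InFrakA n Δ a k₁ k₂) →
    (S : Collection n Δ) → InFrakA n Δ a k₁ k₂ S → RainbowStarFree S
lemma2p2 _ _ a _ k₁ k₂ (s≤s z≤n) _ _ _ _ _ S S∈𝔄 =
  starInDegBound⇒rainbowStarFree S (inFrakA⇒starInDegBound S a k₁ k₂ S∈𝔄)
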